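{- Let $G$ be a finite graph and $m\in\mathbb N$. Then $\mathrm{cm\text{ - }rk}\,G\le m$ if and only if no graph in $\mathcal F_m$ is a minor of $G$.
   Context: Graphs are finite, undirected, without loops or multiple edges. $\mathrm{c\text{ - }rk}\,H$ is the maximum number of independent columns of the $V\times V$ boolean matrix $A^c_H$ (entry $0$ if $\{i,j\}$ is an edge, else $1$), where vectors over the superboolean semiring $\{0,1,1^\nu\}$ (with $0+x=x$, $1+1=1^\nu$, $1^\nu+x=1^\nu$, $0\cdot x=0$, $1\cdot1=1$, $1\cdot1^\nu=1^\nu\cdot1^\nu=1^\nu$) are dependent if some $\{0,1\}$-combination with not all coefficients zero has all coordinates in $\{0,1^\nu\}$, independent otherwise. $G'$ is a minor of $G$ if it is obtained (up to isomorphism) from $G$ by successive vertex deletions, edge deletions and edge contractions (delete an edge $\{v,w\}$ and identify $v$ and $w$). $\mathrm{cm\text{ - }rk}\,G=\max\{\mathrm{c\text{ - }rk}\,G'\mid G'\text{ a minor of }G\}$. For $m\ge1$, $\mathcal F_m$ is a set of representatives of all isomorphism classes of graphs with at most $2m$ vertices and c-rank $m+1$; $\mathcal F_0$ consists of a one-vertex graph. -}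

module Defs where

open import Data.Nat using (ℕ; zero; suc; _≤_; _*_)
open import Data.Bool using (Bool; true; false; T; _∧_; _∨_; not)
open import Data.Fin using (Fin; zero; suc; punchIn)
open import Data.Fin.Subset using (Subset; _∈_; ∣_∣)
open import Data.Product using (Σ; ∃; _×_; _,_)
open import Data.Sum using (_⊎_)
open import Data.Empty using (⊥)
open import Relation.Nullary using (¬_)
open import Relation.Binary.PropositionalEquality using (_≡_; _≢_)
open import Relation.Binary.Construct.Closure.ReflexiveTransitive using (Star)
open import Function.Bundles using (_↔_; Inverse)

record Graph : Set where
  field
    n      : ℕ
    adj    : Fin n → Fin n → Bool
    sym    : ∀ i j → adj i j ≡ adj j i
    irrefl : ∀ i → adj i i ≡ false
open Graph public

Iso : Graph → Graph → Set
Iso H G = Σ (Fin (n H) ↔ Fin (n G)) λ φ →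
  ∀ i j → adj H i j ≡ adj G (Inverse.to φ i) (Inverse.to φ j)

K₁ : Graph
K₁ = record { n = 1 ; adj = λ _ _ → false ; sym = λ _ _ → _≡_.refl ; irrefl = λ _ → _≡_.refl }

-- Superboolean semiring {0, 1, 1^ν}

data SB : Set where
  𝟘 𝟙 𝟙ν : SB

infixl 6 _⊕_
infixl 7 _⊗_

_⊕_ : SB → SB → SB
𝟘  ⊕ x  = x
𝟙  ⊕ 𝟘  = 𝟙
𝟙  ⊕ 𝟙  = 𝟙ν
𝟙  ⊕ 𝟙ν = 𝟙ν
𝟙ν ⊕ _  = 𝟙ν

_⊗_ : SB → SB → SB
𝟘  ⊗ _  = 𝟘
𝟙  ⊗ 𝟘  = 𝟘
𝟙  ⊗ 𝟙  = 𝟙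
𝟙  ⊗ 𝟙ν = 𝟙ν
𝟙ν ⊗ 𝟘  = 𝟘
𝟙ν ⊗ 𝟙  = 𝟙ν
𝟙ν ⊗ 𝟙ν = 𝟙ν

ΣSB : ∀ {k} → (Fin k → SB) → SB
ΣSB {zero}  f = 𝟘
ΣSB {suc k} f = f zero ⊕ ΣSB (λ i → f (suc i))

coef : Bool → SB
coef false = 𝟘
coef true  = 𝟙

ZeroOrGhost : SB → Set
ZeroOrGhost x = (x ≡ 𝟘) ⊎ (x ≡ 𝟙ν)

Ac : (H : Graph) → Fin (n H) → Fin (n H) → SB
Ac H i j with adj H i j
... | true  = 𝟘
... | false = 𝟙

DependentCols : (H : Graph) → Subset (n H) → Set
DependentCols H S = Σ (Fin (n H) → Bool) λ c →
    (∀ j → T (c j) → j ∈ S)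
  × (∃ λ j → T (c j))
  × (∀ i → ZeroOrGhost (ΣSB (λ j → coef (c j) ⊗ Ac H i j)))

IndependentCols : (H : Graph) → Subset (n H) → Set
IndependentCols H S = ¬ DependentCols H S

CRank : Graph → ℕ → Set
CRank H r = (∃ λ S → IndependentCols H S × ∣ S ∣ ≡ r)
          × (∀ S → IndependentCols H S → ∣ S ∣ ≤ r)

DeleteVertex : Graph → Graph → Set
DeleteVertex G' G = Σ (n G ≡ suc (n G')) λ { _≡_.refl →
  Σ (Fin (n G)) λ v → ∀ i j → adj G' i j ≡ adj G (punchIn v i) (punchIn v j) }

DeleteEdge : Graph → Graph → Set
DeleteEdge G' G = Σ (n G' ≡ n G) λ { _≡_.refl →
  Σ (Fin (n G)) λ v → Σ (Fin (n G)) λ w → T (adj G v w) ×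
  (∀ i j → (((i ≡ v) × (j ≡ w)) ⊎ ((i ≡ w) × (j ≡ v)) → adj G' i j ≡ false)
         × (¬ (((i ≡ v) × (j ≡ w)) ⊎ ((i ≡ w) × (j ≡ v))) → adj G' i j ≡ adj G i j)) }

-- G' is G with the edge {v,w} contracted: w is identified with v
-- (the remaining vertices relabelled by punchIn w; v = punchIn w v').
ContractEdge : Graph → Graph → Set
ContractEdge G' G = Σ (n G ≡ suc (n G')) λ { _≡_.refl →
  Σ (Fin (n G)) λ w → Σ (Fin (n G')) λ v' → T (adj G (punchIn w v') w) ×
  (∀ i j → i ≢ j →
     T (adj G' i j) ⇔'
       (T (adj G (punchIn w i) (punchIn w j))
        ⊎ ((i ≡ v') × T (adj G w (punchIn w j)))
        ⊎ ((j ≡ v') × T (adj G (punchIn w i) w)))) }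
  where
  _⇔'_ : Set → Set → Set
  A ⇔' B = (A → B) × (B → A)

Step : Graph → Graph → Set
Step G' G = DeleteVertex G' G ⊎ DeleteEdge G' G ⊎ ContractEdge G' G

Minor : Graph → Graph → Set
Minor H G = ∃ λ G' → Iso H G' × Star Step G' G

CMRank≤ : Graph → ℕ → Set
CMRank≤ G m = ∀ G' → Minor G' G → ∀ r → CRank G' r → r ≤ m

-- membership in (the isomorphism-closure of) 𝓕_m
InF : ℕ → Graph → Set
InF zero    H = Iso H K₁
InF (suc m) H = (n H ≤ 2 * suc m) × CRank H (suc (suc m))

module Submission where

-- c-rk H ≥ k iff H has a triangular system of length k: pairs (i₁,s₁),…,(i_k,s_k) with
-- i_t ≁ s_t and i_t ∼ s_u for t < u (a unitriangular submatrix of A^c_H).  Its columns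
-- are independent; conversely a nonempty independent column set has a pivot row meeting
-- it in a single 1, and peeling off pivots yields a system.
--
-- Graphs of 𝓕_m have c-rank m+1, which gives one direction.  For the other take a minor
-- H of G with a system of length m+1 and fewest vertices.  A vertex unused by the normal
-- form of the system (first and last pair made diagonal) could be deleted, so H has at
-- most 2m vertices (one if m = 0); a system of length m+2 keeps m+1 pairs after deleting
-- its last column, so c-rk H = m+1 and H ∈ 𝓕_m.

open import Defs hiding (sym)
open import Data.Nat using (ℕ; zero; suc; _≤_; _<_; s≤s; z≤n; _*_; _+_; _≤?_)
open import Data.Nat.Properties using (suc-injective; ≤-trans; ≤-pred; ≤-refl; ≰⇒>; 1+n≰n; *-suc; +-comm)
open import Data.Bool using (Bool; true; false; T)
open import Data.Fin using (Fin; zero; suc; _≟_; punchIn; punchOut)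
import Data.Fin.Properties as Fin
open import Data.Fin.Subset using (Subset; _∈_; _∉_; _⊆_; ∣_∣; inside; outside; Nonempty) renaming (⊥ to ∅)
open import Data.Fin.Subset.Properties using (_∈?_; ∉⊥; ∣⊥∣≡0; ∣p∣≤n; nonempty?; Empty-unique)
open import Data.Fin.Permutation using (↔⇒≡)
open import Data.Vec using (_∷_; here; there; _[_]≔_)
open import Data.Vec.Properties using (lookup∘update′; []=⇒lookup; lookup⇒[]=)
open import Data.List using (List; []; _∷_; length; map; _∷ʳ_; initLast; _∷ʳ′_)
open import Data.List.Properties using (length-map; length-++)
open import Data.List.Relation.Unary.All using (All; []; _∷_)
import Data.List.Relation.Unary.All as All
open import Data.List.Relation.Unary.All.Properties using (map⁺; map⁻; ∷ʳ⁻)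
import Data.List.Relation.Unary.Any as Any
open import Data.List.Membership.Propositional using () renaming (_∈_ to _∈ₗ_; _∉_ to _∉ₗ_)
open import Data.List.Membership.Setoid.Properties using (index-injective)
open import Data.Product using (Σ; ∃; ∃₂; _×_; _,_; proj₁; proj₂)
import Data.Product as Product
open import Data.Sum using (_⊎_; inj₁; inj₂)
open import Data.Empty using (⊥; ⊥-elim)
open import Relation.Nullary using (¬_; Dec; yes; no; ¬?; contradiction)
open import Relation.Nullary.Decidable using (isYes; toWitness; fromWitness)
open import Relation.Binary.PropositionalEquality
  using (_≡_; _≢_; refl; sym; trans; cong; cong₂; subst; setoid)
open import Relation.Binary.Construct.Closure.ReflexiveTransitive using (Star; _◅_)
open import Function using (_∘_)
open import Function.Bundles using (Inverse)
open import Function.Construct.Identity using (↔-id)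

⊕≡𝟘⇒ : ∀ x y → x ⊕ y ≡ 𝟘 → x ≡ 𝟘 × y ≡ 𝟘
⊕≡𝟘⇒ 𝟘 y e = refl , e
⊕≡𝟘⇒ 𝟙 𝟘 ()
⊕≡𝟘⇒ 𝟙 𝟙 ()
⊕≡𝟘⇒ 𝟙 𝟙ν ()
⊕≡𝟘⇒ 𝟙ν y ()

⊕≡𝟙⇒ : ∀ x y → x ⊕ y ≡ 𝟙 → (x ≡ 𝟘 × y ≡ 𝟙) ⊎ (x ≡ 𝟙 × y ≡ 𝟘)
⊕≡𝟙⇒ 𝟘 y e = inj₁ (refl , e)
⊕≡𝟙⇒ 𝟙 𝟘 e = inj₂ (refl , refl)
⊕≡𝟙⇒ 𝟙 𝟙 ()
⊕≡𝟙⇒ 𝟙 𝟙ν ()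
⊕≡𝟙⇒ 𝟙ν y ()

ΣSB≡𝟘⇒ : ∀ {k} (f : Fin k → SB) → ΣSB f ≡ 𝟘 → ∀ j → f j ≡ 𝟘
ΣSB≡𝟘⇒ f e zero    = proj₁ (⊕≡𝟘⇒ _ _ e)
ΣSB≡𝟘⇒ f e (suc j) = ΣSB≡𝟘⇒ (f ∘ suc) (proj₂ (⊕≡𝟘⇒ _ _ e)) j

ΣSB-𝟘 : ∀ {k} (f : Fin k → SB) → (∀ j → f j ≡ 𝟘) → ΣSB f ≡ 𝟘
ΣSB-𝟘 {zero}  f f≡𝟘 = refl
ΣSB-𝟘 {suc k} f f≡𝟘 rewrite f≡𝟘 zero = ΣSB-𝟘 (f ∘ suc) (f≡𝟘 ∘ suc)

SingleOne : ∀ {k} → (Fin k → SB) → Fin k → Set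
SingleOne f s = f s ≡ 𝟙 × (∀ j → j ≢ s → f j ≡ 𝟘)

-- A sum equals 𝟙 exactly when it has a single one: two ones already give 1^ν.
ΣSB≡𝟙⇒ : ∀ {k} (f : Fin k → SB) → ΣSB f ≡ 𝟙 → ∃ (SingleOne f)
ΣSB≡𝟙⇒ {suc k} f e with ⊕≡𝟙⇒ (f zero) _ e
... | inj₂ (f₀≡𝟙 , rest≡𝟘) = zero , f₀≡𝟙 , λ { zero 0≢0 → ⊥-elim (0≢0 refl)
                                              ; (suc j) _ → ΣSB≡𝟘⇒ _ rest≡𝟘 j }
... | inj₁ (f₀≡𝟘 , rest≡𝟙) with ΣSB≡𝟙⇒ (f ∘ suc) rest≡𝟙
...   | s , fs≡𝟙 , others = suc s , fs≡𝟙 , λ { zero _ → f₀≡𝟘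
                                             ; (suc j) j≢s → others j (j≢s ∘ cong suc) }

SingleOne⇒ΣSB≡𝟙 : ∀ {k} (f : Fin k → SB) s → SingleOne f s → ΣSB f ≡ 𝟙
SingleOne⇒ΣSB≡𝟙 f zero (fs≡𝟙 , others)
  rewrite fs≡𝟙 | ΣSB-𝟘 (f ∘ suc) (λ j → others (suc j) λ ()) = refl
SingleOne⇒ΣSB≡𝟙 f (suc s) (fs≡𝟙 , others) rewrite others zero (λ ()) =
  SingleOne⇒ΣSB≡𝟙 (f ∘ suc) s (fs≡𝟙 , λ j j≢s → others (suc j) (j≢s ∘ Fin.suc-injective))

zeroOrGhost-or-𝟙 : ∀ x → ZeroOrGhost x ⊎ x ≡ 𝟙
zeroOrGhost-or-𝟙 𝟘  = inj₁ (inj₁ refl)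
zeroOrGhost-or-𝟙 𝟙  = inj₂ refl
zeroOrGhost-or-𝟙 𝟙ν = inj₁ (inj₂ refl)

¬ZeroOrGhost𝟙 : ¬ ZeroOrGhost 𝟙
¬ZeroOrGhost𝟙 (inj₁ ())
¬ZeroOrGhost𝟙 (inj₂ ())

_≟𝟙 : ∀ x → Dec (x ≡ 𝟙)
𝟘  ≟𝟙 = no λ ()
𝟙  ≟𝟙 = yes refl
𝟙ν ≟𝟙 = no λ ()

coef⊗≡𝟘 : ∀ b x → (T b → x ≡ 𝟘) → coef b ⊗ x ≡ 𝟘
coef⊗≡𝟘 false x _   = refl
coef⊗≡𝟘 true  x x≡𝟘 rewrite x≡𝟘 _ = refl

coef⊗≡𝟙⇒ : ∀ b x → coef b ⊗ x ≡ 𝟙 → T b × x ≡ 𝟙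
coef⊗≡𝟙⇒ true 𝟙 refl = _ , refl

coef⊗≡𝟘⇒ : ∀ b x → T b → coef b ⊗ x ≡ 𝟘 → x ≡ 𝟘
coef⊗≡𝟘⇒ true 𝟘 _ refl = refl

Ac-adjacent : ∀ H i j → adj H i j ≡ true → Ac H i j ≡ 𝟘
Ac-adjacent H i j _ with adj H i j
... | true = refl

Ac-nonadjacent : ∀ H i j → adj H i j ≡ false → Ac H i j ≡ 𝟙
Ac-nonadjacent H i j _ with adj H i j
... | false = refl

Ac≡𝟘⇒adjacent : ∀ H i j → Ac H i j ≡ 𝟘 → adj H i j ≡ true
Ac≡𝟘⇒adjacent H i j _ with adj H i j
... | true = refl

Ac≡𝟙⇒nonadjacent : ∀ H i j → Ac H i j ≡ 𝟙 → adj H i j ≡ false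
Ac≡𝟙⇒nonadjacent H i j _ with adj H i j
... | false = refl

∈-update⁻ : ∀ {k} {p : Subset k} {s j} b → j ≢ s → j ∈ p [ s ]≔ b → j ∈ p
∈-update⁻ {p = p} {s} {j} b j≢s j∈ =
  lookup⇒[]= j p (trans (sym (lookup∘update′ j≢s p b)) ([]=⇒lookup j∈))

∉-remove : ∀ {k} (p : Subset k) s → s ∉ p [ s ]≔ outside
∉-remove (x ∷ p) zero    ()
∉-remove (x ∷ p) (suc s) (there s∈) = ∉-remove p s s∈

∈-remove⁻ : ∀ {k} {p : Subset k} {s j} → j ∈ p [ s ]≔ outside → j ≢ s × j ∈ p
∈-remove⁻ {p = p} {s} j∈ = j≢s , ∈-update⁻ outside j≢s j∈
  where
  j≢s : _ ≢ s
  j≢s refl = ∉-remove p s j∈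

∣insert∣ : ∀ {k} (p : Subset k) s → s ∉ p → ∣ p [ s ]≔ inside ∣ ≡ suc ∣ p ∣
∣insert∣ (inside  ∷ p) zero    s∉ = ⊥-elim (s∉ here)
∣insert∣ (outside ∷ p) zero    s∉ = refl
∣insert∣ (inside  ∷ p) (suc s) s∉ = cong suc (∣insert∣ p s (s∉ ∘ there))
∣insert∣ (outside ∷ p) (suc s) s∉ = ∣insert∣ p s (s∉ ∘ there)

∣remove∣ : ∀ {k} (p : Subset k) s → s ∈ p → suc ∣ p [ s ]≔ outside ∣ ≡ ∣ p ∣
∣remove∣ (inside  ∷ p) zero    here       = refl
∣remove∣ (inside  ∷ p) (suc s) (there s∈) = cong suc (∣remove∣ p s s∈)
∣remove∣ (outside ∷ p) (suc s) (there s∈) = ∣remove∣ p s s∈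

nonempty : ∀ {k} (p : Subset k) → 0 < ∣ p ∣ → Nonempty p
nonempty {k} p 0<∣p∣ with nonempty? p
... | yes p≢∅ = p≢∅
... | no  p≡∅ =
  contradiction (subst (0 <_) (∣⊥∣≡0 k) (subst (λ q → 0 < ∣ q ∣) (Empty-unique p≡∅) 0<∣p∣)) λ ()

-- a row/column pair of vertices
Pair : Graph → Set
Pair H = Fin (n H) × Fin (n H)

AdjacentToColumns : (H : Graph) → Fin (n H) → List (Pair H) → Set
AdjacentToColumns H i ps = All (λ q → adj H i (proj₂ q) ≡ true) ps

data Triangular (H : Graph) : List (Pair H) → Set where
  []   : Triangular H []
  cons : ∀ {i s ps} → adj H i s ≡ false → AdjacentToColumns H i ps →
         Triangular H ps → Triangular H ((i , s) ∷ ps)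

-- H has a triangular system of length k (equivalently, c-rk H ≥ k)
HasSystem : Graph → ℕ → Set
HasSystem H k = Σ (List (Pair H)) λ ps → Triangular H ps × length ps ≡ k

columnSet : ∀ {k} → List (Fin k × Fin k) → Subset k
columnSet []             = ∅
columnSet ((i , s) ∷ ps) = columnSet ps [ s ]≔ inside

adjacent-column : ∀ H {i ps j} → AdjacentToColumns H i ps → j ∈ columnSet ps → adj H i j ≡ true
adjacent-column H {ps = []}                _              j∈ = ⊥-elim (∉⊥ j∈)
adjacent-column H {ps = (_ , s) ∷ ps} {j} (i∼s ∷ i∼cols) j∈ with j ≟ s
... | yes refl = i∼s
... | no j≢s   = adjacent-column H i∼cols (∈-update⁻ inside j≢s j∈)

-- the columns of a triangular system are distinct ...
∣columnSet∣ : ∀ {H ps} → Triangular H ps → ∣ columnSet ps ∣ ≡ length ps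
∣columnSet∣ {H} []                                  = ∣⊥∣≡0 (n H)
∣columnSet∣ {H} {(i , s) ∷ ps} (cons i≁s i∼cols t) =
  trans (∣insert∣ (columnSet ps) s s∉) (cong suc (∣columnSet∣ t))
  where
  s∉ : s ∉ columnSet ps
  s∉ s∈ = contradiction (trans (sym i≁s) (adjacent-column H i∼cols s∈)) λ ()

-- ... and independent: in a combination using the first column s₁, row i₁ sums to 𝟙
-- (it meets s₁ in 𝟙 and all later columns in 𝟘); otherwise drop the first pair.
triangular⇒independent : ∀ {H ps} → Triangular H ps → IndependentCols H (columnSet ps)
triangular⇒independent [] (c , supp , (j , cj) , _) = ∉⊥ (supp j cj)
triangular⇒independent {H} {(i , s) ∷ ps} (cons i≁s i∼cols t) (c , supp , nonzero , zog)
  with c s in cs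
... | true  = ¬ZeroOrGhost𝟙 (subst ZeroOrGhost rowᵢ≡𝟙 (zog i))
  where
  rowᵢ≡𝟙 : ΣSB (λ j → coef (c j) ⊗ Ac H i j) ≡ 𝟙
  rowᵢ≡𝟙 = SingleOne⇒ΣSB≡𝟙 _ s
    ( cong₂ _⊗_ (cong coef cs) (Ac-nonadjacent H i s i≁s)
    , λ j j≢s → coef⊗≡𝟘 (c j) _ λ cj →
        Ac-adjacent H i j (adjacent-column H i∼cols (∈-update⁻ inside j≢s (supp j cj))) )
... | false = triangular⇒independent t (c , supp′ , nonzero , zog)
  where
  supp′ : ∀ j → T (c j) → j ∈ columnSet ps
  supp′ j cj with j ≟ s
  ... | yes refl = ⊥-elim (subst T cs cj)
  ... | no j≢s   = ∈-update⁻ inside j≢s (supp j cj)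

system⇒CRank : ∀ {H r} → HasSystem H r → (∀ S → IndependentCols H S → ∣ S ∣ ≤ r) → CRank H r
system⇒CRank (ps , t , len) bound =
  (columnSet ps , triangular⇒independent t , trans (∣columnSet∣ t) len) , bound

indicator : ∀ {k} → Subset k → Fin k → Bool
indicator S j = isYes (j ∈? S)

rowSum : (H : Graph) → Subset (n H) → Fin (n H) → SB
rowSum H S i = ΣSB (λ j → coef (indicator S j) ⊗ Ac H i j)

-- A nonempty independent column set S has a row i meeting it in a single 1: a column
-- s ∈ S with i ≁ s, while i is adjacent to the rest of S.  Otherwise every entry of the
-- sum of the columns of S would lie in {0, 1^ν}.
pivot : ∀ H (S : Subset (n H)) → IndependentCols H S → Nonempty S →
        ∃₂ λ i s → s ∈ S × adj H i s ≡ false × (∀ j → j ∈ S → j ≢ s → adj H i j ≡ true)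
pivot H S ind (j₀ , j₀∈S) with Fin.any? (λ i → rowSum H S i ≟𝟙)
... | no ¬∃ = ⊥-elim (ind (indicator S , (λ j → toWitness) , (j₀ , fromWitness j₀∈S) , allZeroOrGhost))
  where
  allZeroOrGhost : ∀ i → ZeroOrGhost (rowSum H S i)
  allZeroOrGhost i with zeroOrGhost-or-𝟙 (rowSum H S i)
  ... | inj₁ zog    = zog
  ... | inj₂ row≡𝟙 = ⊥-elim (¬∃ (i , row≡𝟙))
... | yes (i , row≡𝟙) with ΣSB≡𝟙⇒ _ row≡𝟙
...   | s , fs≡𝟙 , others with coef⊗≡𝟙⇒ _ _ fs≡𝟙
...     | s∈S , Acᵢₛ≡𝟙 =
  i , s , toWitness s∈S , Ac≡𝟙⇒nonadjacent H i s Acᵢₛ≡𝟙 ,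
  λ j j∈S j≢s → Ac≡𝟘⇒adjacent H i j (coef⊗≡𝟘⇒ _ _ (fromWitness j∈S) (others j j≢s))

independent-⊆ : ∀ H {S′ S : Subset (n H)} → S′ ⊆ S → IndependentCols H S → IndependentCols H S′
independent-⊆ H S′⊆S ind (c , supp , nonzero , zog) = ind (c , (λ j → S′⊆S ∘ supp j) , nonzero , zog)

-- Take a pivot (i , s) of S and recurse on S - s, to which row i is adjacent.
greedy : ∀ H k (S : Subset (n H)) → k ≤ ∣ S ∣ → IndependentCols H S →
         Σ (List (Pair H)) λ ps → Triangular H ps × length ps ≡ k × All (λ q → proj₂ q ∈ S) ps
greedy H zero    S _ _ = [] , [] , refl , []
greedy H (suc k) S k<∣S∣ ind with pivot H S ind (nonempty S (≤-trans (s≤s z≤n) k<∣S∣))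
... | i , s , s∈S , i≁s , i∼S
  with greedy H k (S [ s ]≔ outside)
         (≤-pred (subst (suc k ≤_) (sym (∣remove∣ S s s∈S)) k<∣S∣))
         (independent-⊆ H (proj₂ ∘ ∈-remove⁻) ind)
...   | ps , t , len , cols∈S′ =
  (i , s) ∷ ps ,
  cons i≁s (All.map (λ q∈ → let (q≢s , q∈S) = ∈-remove⁻ q∈ in i∼S _ q∈S q≢s) cols∈S′) t ,
  cong suc len ,
  s∈S ∷ All.map (proj₂ ∘ ∈-remove⁻) cols∈S′

independent⇒system : ∀ H k (S : Subset (n H)) → k ≤ ∣ S ∣ → IndependentCols H S → HasSystem H k
independent⇒system H k S k≤∣S∣ ind with greedy H k S k≤∣S∣ ind
... | ps , t , len , _ = ps , t , len

InducedEmbedding : (K H : Graph) → (Fin (n K) → Fin (n H)) → Set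
InducedEmbedding K H f = ∀ i j → adj K i j ≡ adj H (f i) (f j)

pairMap : ∀ {A B : Set} → (A → B) → A × A → B × B
pairMap f = Product.map f f

triangular-push : ∀ {K H f} → InducedEmbedding K H f → ∀ {ps} →
                  Triangular K ps → Triangular H (map (pairMap f) ps)
triangular-push emb []                   = []
triangular-push emb (cons i≁s i∼cols t) =
  cons (trans (sym (emb _ _)) i≁s) (map⁺ (All.map (trans (sym (emb _ _))) i∼cols)) (triangular-push emb t)

triangular-pull : ∀ {K H f} → InducedEmbedding K H f → ∀ ps →
                  Triangular H (map (pairMap f) ps) → Triangular K ps
triangular-pull emb []             []                   = []
triangular-pull emb ((i , s) ∷ ps) (cons i≁s i∼cols t) =
  cons (trans (emb i s) i≁s) (All.map (trans (emb _ _)) (map⁻ i∼cols)) (triangular-pull emb ps t)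

system-iso : ∀ {H K k} → Iso H K → HasSystem H k → HasSystem K k
system-iso (φ , pres) (ps , t , len) =
  map (pairMap (Inverse.to φ)) ps , triangular-push pres t , trans (length-map _ ps) len

Both : ∀ {A : Set} → (A → Set) → A × A → Set
Both P (i , s) = P i × P s

Avoids : ∀ {k} → Fin k → Fin k × Fin k → Set
Avoids x = Both (x ≢_)

removeVertex : (H : Graph) → Fin (n H) → Graph
removeVertex record { n = suc k ; adj = a ; sym = a-sym ; irrefl = a-irrefl } x = record
  { n = k ; adj = λ i j → a (punchIn x i) (punchIn x j) ; sym = λ i j → a-sym _ _ ; irrefl = λ i → a-irrefl _ }

unpunch : ∀ {k} (x : Fin (suc k)) ps → All (Avoids x) ps →
          Σ (List (Fin k × Fin k)) λ ps′ → map (pairMap (punchIn x)) ps′ ≡ ps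
unpunch x []             []                     = [] , refl
unpunch x ((i , s) ∷ ps) ((x≢i , x≢s) ∷ avoids) with unpunch x ps avoids
... | ps′ , eq = (punchOut x≢i , punchOut x≢s) ∷ ps′ ,
                 cong₂ _∷_ (cong₂ _,_ (Fin.punchIn-punchOut x≢i) (Fin.punchIn-punchOut x≢s)) eq

deleteAvoided : ∀ H x ps → Triangular H ps → All (Avoids x) ps →
                Σ Graph λ K → Step K H × suc (n K) ≡ n H × HasSystem K (length ps)
deleteAvoided record { n = zero } ()
deleteAvoided H@record { n = suc k } x ps t avoids with unpunch x ps avoids
... | ps′ , refl =
  removeVertex H x , inj₁ (refl , x , λ i j → refl) , refl ,
  ps′ , triangular-pull (λ i j → refl) ps′ t , sym (length-map _ ps′)

-- The last column s is adjacent to every earlier row; as a row is adjacent neither to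
-- itself nor to its own column, no earlier pair uses s.
dropLast : ∀ {H} ps {i s} → Triangular H (ps ∷ʳ (i , s)) → Triangular H ps × All (Avoids s) ps
dropLast []                 _                    = [] , []
dropLast {H} ((r , c) ∷ ps) (cons r≁c r∼cols t) with ∷ʳ⁻ r∼cols | dropLast ps t
... | r∼cols′ , r∼s | t′ , avoids = cons r≁c r∼cols′ t′ , (s≢r , s≢c) ∷ avoids
  where
  s≢r : _ ≢ r
  s≢r refl = contradiction (trans (sym (irrefl H r)) r∼s) λ ()
  s≢c : _ ≢ c
  s≢c refl = contradiction (trans (sym r≁c) r∼s) λ ()

shrinkSystem : ∀ {H k} → HasSystem H (suc k) →
               ∃ λ x → Σ (List (Pair H)) λ ps → Triangular H ps × length ps ≡ k × All (Avoids x) ps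
shrinkSystem (ps , t , len) with initLast ps
shrinkSystem (.[] , t , ()) | []
shrinkSystem (.(ps ∷ʳ (i , s)) , t , len) | ps ∷ʳ′ (i , s) =
  s , ps , proj₁ (dropLast ps t) ,
  suc-injective (trans (+-comm 1 _) (trans (sym (length-++ ps)) len)) ,
  proj₂ (dropLast ps t)

-- Normal form: (i₁,s₁) becomes (i₁,i₁) and (i_L,s_L) becomes (s_L,s_L).  This keeps
-- the system triangular, and it then uses at most 2(L-1) vertices (one if L = 1).

module _ {A : Set} where

  diagLast : List (A × A) → List (A × A)
  diagLast []             = []
  diagLast ((i , s) ∷ []) = (s , s) ∷ []
  diagLast (p ∷ q ∷ ps)   = p ∷ diagLast (q ∷ ps)

  normalize : List (A × A) → List (A × A)
  normalize []             = []
  normalize ((i , s) ∷ ps) = (i , i) ∷ diagLast ps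

  inner : List (A × A) → List A
  inner []                 = []
  inner ((i , s) ∷ [])     = s ∷ []
  inner ((i , s) ∷ q ∷ ps) = i ∷ s ∷ inner (q ∷ ps)

  verts : List (A × A) → List A
  verts []             = []
  verts ((i , s) ∷ ps) = i ∷ inner ps

  diagLast-columns : ∀ {P : A → Set} ps → All (P ∘ proj₂) ps → All (P ∘ proj₂) (diagLast ps)
  diagLast-columns []           []        = []
  diagLast-columns (_ ∷ [])     (p ∷ [])  = p ∷ []
  diagLast-columns (_ ∷ q ∷ ps) (p ∷ ps′) = p ∷ diagLast-columns (q ∷ ps) ps′

  length-diagLast : ∀ ps → length (diagLast ps) ≡ length ps
  length-diagLast []           = refl
  length-diagLast (_ ∷ [])     = refl
  length-diagLast (_ ∷ q ∷ ps) = cong suc (length-diagLast (q ∷ ps))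

  length-normalize : ∀ ps → length (normalize ps) ≡ length ps
  length-normalize []       = refl
  length-normalize (_ ∷ ps) = cong suc (length-diagLast ps)

  inner-covers : ∀ ps → All (Both (_∈ₗ inner ps)) (diagLast ps)
  inner-covers []                 = []
  inner-covers ((i , s) ∷ [])     = (Any.here refl , Any.here refl) ∷ []
  inner-covers ((i , s) ∷ q ∷ ps) =
    (Any.here refl , Any.there (Any.here refl)) ∷
    All.map (Product.map (Any.there ∘ Any.there) (Any.there ∘ Any.there)) (inner-covers (q ∷ ps))

  verts-covers : ∀ ps → All (Both (_∈ₗ verts ps)) (normalize ps)
  verts-covers []             = []
  verts-covers ((i , s) ∷ ps) =
    (Any.here refl , Any.here refl) ∷ All.map (Product.map Any.there Any.there) (inner-covers ps)

  -- for a system of L ≥ 2 pairs, verts has 2(L-1) elements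
  length-inner : ∀ q ps → suc (length (inner (q ∷ ps))) ≡ 2 * length (q ∷ ps)
  length-inner q []       = refl
  length-inner q (r ∷ ps) = trans (cong (2 +_) (length-inner r ps)) (sym (*-suc 2 (length (r ∷ ps))))

triangular-diagLast : ∀ {H} ps → Triangular H ps → Triangular H (diagLast ps)
triangular-diagLast     []             []                   = []
triangular-diagLast {H} ((i , s) ∷ []) (cons _ _ [])        = cons (irrefl H s) [] []
triangular-diagLast     (_ ∷ q ∷ ps)   (cons i≁s i∼cols t) =
  cons i≁s (diagLast-columns (q ∷ ps) i∼cols) (triangular-diagLast (q ∷ ps) t)

triangular-normalize : ∀ {H} ps → Triangular H ps → Triangular H (normalize ps)
triangular-normalize     []             []                 = []
triangular-normalize {H} ((i , s) ∷ ps) (cons _ i∼cols t) =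
  cons (irrefl H i) (diagLast-columns ps i∼cols) (triangular-diagLast ps t)

outside⇒avoids : ∀ {k} {x : Fin k} {xs} → x ∉ₗ xs → ∀ {ps} → All (Both (_∈ₗ xs)) ps → All (Avoids x) ps
outside⇒avoids x∉ = All.map λ (i∈ , s∈) → (λ { refl → x∉ i∈ }) , (λ { refl → x∉ s∈ })

covering⇒≤length : ∀ {k} (xs : List (Fin k)) → (∀ x → x ∈ₗ xs) → k ≤ length xs
covering⇒≤length xs covers =
  Fin.injective⇒≤ {f = Any.index ∘ covers} λ {x} {y} → index-injective (setoid _) (covers x) (covers y)

_∈ₗ?_ : ∀ {k} (x : Fin k) xs → Dec (x ∈ₗ xs)
x ∈ₗ? xs = Any.any? (x ≟_) xs

isoRefl : ∀ H → Iso H H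
isoRefl H = ↔-id (Fin (n H)) , λ i j → refl

single⇒K₁ : ∀ H → n H ≤ 1 → Fin (n H) → Iso H K₁
single⇒K₁ record { n = suc zero ; irrefl = irr } _ _ = ↔-id (Fin 1) , λ { zero zero → irr zero }
single⇒K₁ record { n = suc (suc _) } (s≤s ()) _

F⇒CRank : ∀ m H → InF m H → CRank H (suc m)
F⇒CRank zero    H (φ , _) =
  system⇒CRank {H} ((v , v) ∷ [] , cons (irrefl H v) [] [] , refl)
               (λ S _ → subst (∣ S ∣ ≤_) (↔⇒≡ φ) (∣p∣≤n S))
  where v = Inverse.from φ zero
F⇒CRank (suc m) H (_ , crank) = crank

covered⇒F : ∀ m H ps → Triangular H ps → length ps ≡ suc m → (∀ x → x ∈ₗ verts ps) →
            (∀ S → IndependentCols H S → ∣ S ∣ ≤ suc m) → InF m H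
covered⇒F zero    H ((i , s) ∷ []) t len covers bound = single⇒K₁ H (covering⇒≤length _ covers) i
covered⇒F (suc m) H (p ∷ q ∷ ps)   t len covers bound =
  subst (n H ≤_) (trans (length-inner q ps) (cong (2 *_) (suc-injective len))) (covering⇒≤length _ covers) ,
  system⇒CRank (p ∷ q ∷ ps , t , len) bound

-- If no graph of 𝓕_m is a minor of G, no graph H obtained from G by minor steps has a
-- triangular system of length m+1.  By induction on k ≥ n H: a vertex unused by the
-- normal form of the system can be deleted; otherwise H has few vertices, and an
-- independent set of m+2 columns yields (after deleting its last column) a system of
-- length m+1 on a smaller graph; so H ∈ 𝓕_m, a contradiction.
module MinimalCounterexample (G : Graph) (m : ℕ) (noF : ∀ H → InF m H → ¬ Minor H G) where

  noSystem : ∀ k H → n H ≤ k → Star Step H G → HasSystem H (suc m) → ⊥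
  noSystem zero    H le st ((i , _) ∷ _ , _) = contradiction (≤-trans (Fin.toℕ<n i) le) λ ()
  noSystem (suc k) H le st (ps , t , len) = splitOnUnusedVertex (Fin.any? λ x → ¬? (x ∈ₗ? verts ps))
    where
    deleteAndRecurse : ∀ x qs → Triangular H qs → length qs ≡ suc m → All (Avoids x) qs → ⊥
    deleteAndRecurse x qs tq lenq avoids with deleteAvoided H x qs tq avoids
    ... | K , step , order , sys =
      noSystem k K (≤-pred (subst (_≤ suc k) (sym order) le)) (step ◅ st) (subst (HasSystem K) lenq sys)

    rankBound : ∀ S → IndependentCols H S → ∣ S ∣ ≤ suc m
    rankBound S ind with ∣ S ∣ ≤? suc m
    ... | yes ≤m+1 = ≤m+1
    ... | no ≰m+1 with shrinkSystem (independent⇒system H (suc (suc m)) S (≰⇒> ≰m+1) ind)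
    ...   | x , qs , tq , lenq , avoids = ⊥-elim (deleteAndRecurse x qs tq lenq avoids)

    splitOnUnusedVertex : Dec (∃ λ x → x ∉ₗ verts ps) → ⊥
    splitOnUnusedVertex (yes (x , x∉)) =
      deleteAndRecurse x (normalize ps) (triangular-normalize ps t) (trans (length-normalize ps) len)
        (outside⇒avoids x∉ (verts-covers ps))
    splitOnUnusedVertex (no ¬unused) =
      noF H (covered⇒F m H ps t len covers rankBound) (H , isoRefl H , st)
      where
      covers : ∀ x → x ∈ₗ verts ps
      covers x with x ∈ₗ? verts ps
      ... | yes x∈ = x∈
      ... | no x∉  = ⊥-elim (¬unused (x , x∉))

proposition8p1 : (G : Graph) (m : ℕ) →
    (CMRank≤ G m → ∀ H → InF m H → ¬ Minor H G)
    × ((∀ H → InF m H → ¬ Minor H G) → CMRank≤ G m)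
proposition8p1 G m = F-excluded , bounded
  where
  F-excluded : CMRank≤ G m → ∀ H → InF m H → ¬ Minor H G
  F-excluded cm H H∈F H≼G = 1+n≰n (cm H H≼G (suc m) (F⇒CRank m H H∈F))

  bounded : (∀ H → InF m H → ¬ Minor H G) → CMRank≤ G m
  bounded noF H (K , H≅K , st) r ((S , ind , ∣S∣≡r) , _) with r ≤? m
  ... | yes r≤m = r≤m
  ... | no r≰m  = ⊥-elim (MinimalCounterexample.noSystem G m noF (n K) K ≤-refl st (system-iso H≅K systemH))
    where
    systemH : HasSystem H (suc m)
    systemH = independent⇒system H (suc m) S (subst (suc m ≤_) (sym ∣S∣≡r) (≰⇒> r≰m)) ind
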